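{- There exists an infinite family of tries $\mathcal{T}$ (with unboundedly many nodes $n$) such that $r(\mathcal{T})=\Theta(n\mathcal{H}_0(\mathcal{T}))$.
   Context: A trie is a finite rooted tree with edges labeled by symbols of a totally ordered alphabet $\Sigma$, outgoing edges of a node having distinct labels, siblings ordered by label. Logarithms base 2, $0\log(x/0)=0$. If $c_i$ labels $n_i$ edges and $\mathcal{T}$ has $n$ nodes, $\mathcal{H}_0(\mathcal{T})=\sum_{i}\left[\frac{n_i}{n}\log\frac{n}{n_i}+\frac{n-n_i}{n}\log\frac{n}{n-n_i}\right]$. Let $u_1,\ldots,u_n$ be the nodes sorted co-lexicographically (strings compared from right to left, empty string smallest) by the label of the path from the root to the node, and let $out(u)$ be the set of labels of edges outgoing from $u$. An index $i\in[n]$ is a $c$-run break if $c\in out(u_i)$ and either $i=n$ or $c\notin out(u_{i+1})$; $r_c$ is the number of $c$-run breaks, and $r(\mathcal{T})=\sum_{c\in\Sigma}r_c$ is the number of runs of the XBWT. -}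

module Defs where

open import Data.Nat using (ℕ; zero; suc; _+_; _*_; _∸_; _^_; _≤_)
open import Data.Bool using (Bool; true; false; if_then_else_; _∧_; not)
open import Data.Fin as Fin using (Fin)
open import Data.Fin.Properties using (_≟_; _<?_)
open import Data.List using (List; []; _∷_; _++_; map; length; filter; reverse; foldr)
open import Data.Bool.ListAction using (any)
open import Data.List.Relation.Unary.Linked using (Linked)
open import Data.Product using (_×_; _,_; proj₁; proj₂)
open import Data.Unit using (⊤)
open import Relation.Nullary.Decidable using (⌊_⌋)

data Trie (σ : ℕ) : Set where
  node : List (Fin σ × Trie σ) → Trie σ

mutual
  WF : ∀ {σ} → Trie σ → Set
  WF (node cs) = Linked (λ x y → proj₁ x Fin.< proj₁ y) cs × WFs cs

  WFs : ∀ {σ} → List (Fin σ × Trie σ) → Set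
  WFs []             = ⊤
  WFs ((_ , t) ∷ cs) = WF t × WFs cs

-- All nodes, each given as (path label from the root, out-set as a list).
mutual
  entries : ∀ {σ} → Trie σ → List (List (Fin σ) × List (Fin σ))
  entries (node cs) = ([] , map proj₁ cs) ∷ entriesChildren cs

  entriesChildren : ∀ {σ} → List (Fin σ × Trie σ) → List (List (Fin σ) × List (Fin σ))
  entriesChildren []             = []
  entriesChildren ((c , t) ∷ cs) =
    map (λ e → (c ∷ proj₁ e , proj₂ e)) (entries t) ++ entriesChildren cs

mutual
  edgeLabels : ∀ {σ} → Trie σ → List (Fin σ)
  edgeLabels (node cs) = edgeLabelsChildren cs

  edgeLabelsChildren : ∀ {σ} → List (Fin σ × Trie σ) → List (Fin σ)
  edgeLabelsChildren []             = []
  edgeLabelsChildren ((c , t) ∷ cs) = c ∷ edgeLabels t ++ edgeLabelsChildren cs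

size : ∀ {σ} → Trie σ → ℕ
size t = length (entries t)

edgeCount : ∀ {σ} → Trie σ → Fin σ → ℕ
edgeCount t c = length (filter (λ d → c ≟ d) (edgeLabels t))

lexLt : ∀ {σ} → List (Fin σ) → List (Fin σ) → Bool
lexLt []       []       = false
lexLt []       (_ ∷ _)  = true
lexLt (_ ∷ _)  []       = false
lexLt (a ∷ as) (b ∷ bs) =
  if ⌊ a <? b ⌋ then true else (if ⌊ a ≟ b ⌋ then lexLt as bs else false)

colexLt : ∀ {σ} → List (Fin σ) → List (Fin σ) → Bool
colexLt u v = lexLt (reverse u) (reverse v)

insert : ∀ {σ} → List (Fin σ) × List (Fin σ) → List (List (Fin σ) × List (Fin σ))
       → List (List (Fin σ) × List (Fin σ))
insert e []       = e ∷ []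
insert e (x ∷ xs) = if colexLt (proj₁ e) (proj₁ x) then e ∷ x ∷ xs else x ∷ insert e xs

isort : ∀ {σ} → List (List (Fin σ) × List (Fin σ)) → List (List (Fin σ) × List (Fin σ))
isort = foldr insert []

sortedOuts : ∀ {σ} → Trie σ → List (List (Fin σ))
sortedOuts t = map proj₂ (isort (entries t))

memb : ∀ {σ} → Fin σ → List (Fin σ) → Bool
memb c = any (λ d → ⌊ c ≟ d ⌋)

b2n : Bool → ℕ
b2n true  = 1
b2n false = 0

breaks : ∀ {σ} → Fin σ → List (List (Fin σ)) → ℕ
breaks c []             = 0
breaks c (o ∷ [])       = b2n (memb c o)
breaks c (o ∷ o' ∷ os)  = b2n (memb c o ∧ not (memb c o')) + breaks c (o' ∷ os)

sumFin : ∀ σ → (Fin σ → ℕ) → ℕ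
sumFin zero    f = 0
sumFin (suc σ) f = f Fin.zero + sumFin σ (λ i → f (Fin.suc i))

prodFin : ∀ σ → (Fin σ → ℕ) → ℕ
prodFin zero    f = 1
prodFin (suc σ) f = f Fin.zero * prodFin σ (λ i → f (Fin.suc i))

runs : ∀ {σ} → Trie σ → ℕ
runs {σ} t = sumFin σ (λ c → breaks c (sortedOuts t))

-- n·H₀(T) without reals.
--   n·H₀(T) = Σ_c [ n_c log(n/n_c) + (n-n_c) log(n/(n-n_c)) ]
--           = log₂ ( nH0num T / nH0den T )
-- where nH0num = Π_c n^n and nH0den = Π_c n_c^{n_c} (n-n_c)^{n-n_c}
-- (0^0 = 1 in Agda, matching the convention 0 log(x/0) = 0).

nH0num : ∀ {σ} → Trie σ → ℕ
nH0num {σ} t = prodFin σ (λ _ → size t ^ size t)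

nH0den : ∀ {σ} → Trie σ → ℕ
nH0den {σ} t = prodFin σ (λ c →
  (edgeCount t c ^ edgeCount t c) * ((size t ∸ edgeCount t c) ^ (size t ∸ edgeCount t c)))

-- For p, q > 0:  (p/q)·log₂(N/D) ≤ x   ⇔   N^p ≤ 2^(q·x) · D^p
ScaledLogLe : ℕ → ℕ → ℕ → ℕ → ℕ → Set
ScaledLogLe p q N D x = N ^ p ≤ 2 ^ (q * x) * D ^ p

-- For p, q > 0:  x ≤ (p/q)·log₂(N/D)   ⇔   2^(q·x) · D^p ≤ N^p
LeScaledLog : ℕ → ℕ → ℕ → ℕ → ℕ → Set
LeScaledLog p q N D x = 2 ^ (q * x) * D ^ p ≤ N ^ p

-- The ladder trie over {a < b} has a spine of a-edges from the root down to depth 2m + 1;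
-- every spine node also has a b-child, and the b-children at even depth carry one a-edge
-- to a leaf.  Co-lexicographically the spine comes first, then the leaves below the
-- b-children, then the b-children themselves, whose out-sets alternate {a}, ∅.  Hence the
-- XBWT has m + 2 a-runs and a single b-run, r = m + 3, while both letter frequencies lie
-- between 1/4 and 3/4 of the n = 5(m + 1) nodes, which pins n·H₀ between 2(m + 1) and 4n.

module Submission where

open import Defs
open import Data.Nat using (ℕ; zero; suc; _+_; _*_; _∸_; _^_; _≤_; _<_; _>_; z≤n; s≤s)
open import Data.Nat.Properties
  using (+-identityʳ; +-suc; +-comm; *-assoc; *-identityʳ; ≤-refl; ≤-trans; <⇒≤; n≤1+n;
         m≤m+n; m≤n+m; +-monoʳ-≤; *-mono-≤; *-monoˡ-≤; ^-monoˡ-≤; ^-monoʳ-≤;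
         ^-distribˡ-+-*; ^-*-assoc; m+n∸m≡n; m+n≤o⇒m≤o; ≤-reflexive; +-monoˡ-≤; module ≤-Reasoning)
open import Data.Nat.Tactic.RingSolver using (solve-∀)
open import Data.Bool using (true; false; _∧_; not)
open import Data.Bool.Properties using (∧-identityʳ)
open import Data.Fin as Fin using (Fin)
open import Data.Fin.Properties using (_≟_)
open import Data.List
  using (List; []; _∷_; _++_; _∷ʳ_; map; length; filter; reverse; replicate; foldr; concat; applyUpTo)
open import Data.List.Properties
  using (++-assoc; ++-identityʳ; ∷ʳ-++; map-++; length-++; length-map; filter-++; foldr-++;
         reverse-++; unfold-reverse; map-id; applyUpTo-∷ʳ; map-applyUpTo; concat-map; concat-++)
open import Data.List.Relation.Unary.Linked using ([]; [-]; _∷_)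
open import Data.List.Relation.Unary.All using (All; []; _∷_)
open import Data.List.Relation.Unary.All.Properties using (++⁺; concat⁺; applyUpTo⁺₁; applyUpTo⁺₂)
open import Data.Product using (_×_; _,_; proj₁; proj₂; ∃)
open import Data.Unit using (tt)
open import Function using (_∘_)
open import Relation.Binary.PropositionalEquality

module _ {σ : ℕ} (c : Fin σ) where

  breaks-[]∷ : ∀ os → breaks c ([] ∷ os) ≡ breaks c os
  breaks-[]∷ []       = refl
  breaks-[]∷ (_ ∷ _) = refl

  breaks-replicate : ∀ o j os → breaks c (o ∷ replicate j o ++ os) ≡ breaks c (o ∷ os)
  breaks-replicate o zero    os = refl
  breaks-replicate o (suc j) os =
    cong₂ _+_ (no-break (memb c o)) (breaks-replicate o j os)
    where
    no-break : ∀ x → b2n (x ∧ not x) ≡ 0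
    no-break true  = refl
    no-break false = refl

  breaks-replicate-[] : ∀ k os → breaks c (replicate k [] ++ os) ≡ breaks c os
  breaks-replicate-[] zero    os = refl
  breaks-replicate-[] (suc k) os =
    trans (breaks-[]∷ (replicate k [] ++ os)) (breaks-replicate-[] k os)

  breaks-∷[]∷ : ∀ o xs → breaks c (o ∷ [] ∷ xs) ≡ b2n (memb c o) + breaks c xs
  breaks-∷[]∷ o xs = cong₂ _+_ (cong b2n (∧-identityʳ (memb c o))) (breaks-[]∷ xs)

  breaks-alternating : ∀ o k → breaks c (concat (replicate k (o ∷ [] ∷ []))) ≡ k * b2n (memb c o)
  breaks-alternating o zero    = refl
  breaks-alternating o (suc k) =
    trans (breaks-∷[]∷ o (concat (replicate k (o ∷ [] ∷ [])))) (cong (b2n (memb c o) +_) (breaks-alternating o k))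

a b : Fin 2
a = Fin.zero
b = Fin.suc Fin.zero

both onlyA onlyB : List (Fin 2)
both  = a ∷ b ∷ []
onlyA = a ∷ []
onlyB = b ∷ []

leaf : Trie 2
leaf = node []

pendant : Fin 2 → Trie 2
pendant c = node ((c , leaf) ∷ [])

ladder : ℕ → Trie 2
ladder zero    = node ((a , pendant b) ∷ (b , pendant a) ∷ [])
ladder (suc t) = node ((a , node ((a , ladder t) ∷ (b , leaf) ∷ [])) ∷ (b , pendant a) ∷ [])

wf-ladder : ∀ t → WF (ladder t)
wf-ladder zero    = (s≤s z≤n ∷ [-]) , ([-] , ([] , tt) , tt) , ([-] , ([] , tt) , tt) , tt
wf-ladder (suc t) = (s≤s z≤n ∷ [-]) , ((s≤s z≤n ∷ [-]) , wf-ladder t , ([] , tt) , tt) , ([-] , ([] , tt) , tt) , tt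

Entry : Set
Entry = List (Fin 2) × List (Fin 2)

double : ℕ → ℕ
double zero    = zero
double (suc n) = suc (suc (double n))

spine : ℕ → List (Fin 2)
spine d = replicate d a

spineNode : ℕ → List (Fin 2) → Entry
spineNode d o = (spine d , o)

branchNode : ℕ → List (Fin 2) → Entry
branchNode d o = (spine d ++ b ∷ [] , o)

leafNode : ℕ → Entry
leafNode d = (spine d ++ b ∷ a ∷ [] , [])

rungTail : ℕ → List Entry
rungTail u = branchNode (suc (double u)) [] ∷ branchNode (double u) onlyA ∷ leafNode (double u) ∷ []

-- the nodes of ladder t, hung at depth 2u of the spine, in preorder
preorderFrom : ℕ → ℕ → List Entry
preorderFrom u zero    = spineNode (double u) both ∷ spineNode (suc (double u)) onlyB ∷ rungTail u
preorderFrom u (suc t) =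
  spineNode (double u) both ∷ spineNode (suc (double u)) both ∷ preorderFrom (suc u) t ++ rungTail u

under : List (Fin 2) → Entry → Entry
under p e = (p ++ proj₁ e , proj₂ e)

below : Fin 2 → Entry → Entry
below c e = (c ∷ proj₁ e , proj₂ e)

spine-++-a∷ : ∀ d p → spine d ++ a ∷ p ≡ a ∷ spine d ++ p
spine-++-a∷ zero    p = refl
spine-++-a∷ (suc d) p = cong (a ∷_) (spine-++-a∷ d p)

spine-∷ʳ : ∀ d → spine d ∷ʳ a ≡ spine (suc d)
spine-∷ʳ d = trans (spine-++-a∷ d []) (cong (a ∷_) (++-identityʳ (spine d)))

under-below : ∀ d es → map (under (spine d)) (map (below a) es) ≡ map (under (spine (suc d))) es
under-below d []       = refl
under-below d (e ∷ es) = cong₂ _∷_ (cong (_, proj₂ e) (spine-++-a∷ d (proj₁ e))) (under-below d es)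

entries-ladder : ∀ t u → map (under (spine (double u))) (entries (ladder t)) ≡ preorderFrom u t
entries-ladder zero u =
  cong₂ _∷_ (cong (_, both) (++-identityʳ (spine d)))
  (cong₂ _∷_ (cong (_, onlyB) (spine-∷ʳ d))
  (cong₂ _∷_ (cong (_, []) (spine-++-a∷ d (b ∷ []))) refl))
  where d = double u
entries-ladder (suc t) u =
  cong₂ _∷_ (cong (_, both) (++-identityʳ (spine d)))
  (cong₂ _∷_ (cong (_, both) (spine-∷ʳ d)) (begin
    map (under P) (map (below a) (map (below a) E ++ B₁) ++ B₀)
      ≡⟨ map-++ (under P) (map (below a) (map (below a) E ++ B₁)) B₀ ⟩
    map (under P) (map (below a) (map (below a) E ++ B₁)) ++ map (under P) B₀
      ≡⟨ cong (_++ map (under P) B₀) (under-below d (map (below a) E ++ B₁)) ⟩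
    map (under P′) (map (below a) E ++ B₁) ++ map (under P) B₀
      ≡⟨ cong (_++ map (under P) B₀) (map-++ (under P′) (map (below a) E) B₁) ⟩
    (map (under P′) (map (below a) E) ++ map (under P′) B₁) ++ map (under P) B₀
      ≡⟨ cong (λ z → (z ++ map (under P′) B₁) ++ map (under P) B₀)
              (trans (under-below (suc d) E) (entries-ladder t (suc u))) ⟩
    (preorderFrom (suc u) t ++ map (under P′) B₁) ++ map (under P) B₀
      ≡⟨ ++-assoc (preorderFrom (suc u) t) (map (under P′) B₁) (map (under P) B₀) ⟩
    preorderFrom (suc u) t ++ rungTail u ∎))
  where
  open ≡-Reasoning
  d = double u
  P = spine d
  P′ = spine (suc d)
  E = entries (ladder t)
  B₁ B₀ : List Entry
  B₁ = (b ∷ [] , []) ∷ []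
  B₀ = (b ∷ [] , onlyA) ∷ (b ∷ a ∷ [] , []) ∷ []

_≺_ _⊀_ : Entry → Entry → Set
e ≺ e′ = colexLt (proj₁ e) (proj₁ e′) ≡ true
e ⊀ e′ = colexLt (proj₁ e) (proj₁ e′) ≡ false

reverse-spine : ∀ d → reverse (spine d) ≡ spine d
reverse-spine zero    = refl
reverse-spine (suc d) = begin
  reverse (a ∷ spine d)   ≡⟨ unfold-reverse a (spine d) ⟩
  reverse (spine d) ∷ʳ a  ≡⟨ cong (_∷ʳ a) (reverse-spine d) ⟩
  spine d ∷ʳ a            ≡⟨ spine-∷ʳ d ⟩
  spine (suc d)           ∎
  where open ≡-Reasoning

reverse-spine-++ : ∀ d q → reverse (spine d ++ q) ≡ reverse q ++ spine d
reverse-spine-++ d q = trans (reverse-++ (spine d) q) (cong (reverse q ++_) (reverse-spine d))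

lexLt-spine-< : ∀ {d d′} → d < d′ → lexLt (spine d) (spine d′) ≡ true
lexLt-spine-< {zero}  (s≤s _) = refl
lexLt-spine-< {suc d} (s≤s p) = lexLt-spine-< p

lexLt-spine-≥ : ∀ {d d′} → d′ ≤ d → lexLt (spine d) (spine d′) ≡ false
lexLt-spine-≥ {zero}  z≤n     = refl
lexLt-spine-≥ {suc d} z≤n     = refl
lexLt-spine-≥         (s≤s p) = lexLt-spine-≥ p

lexLt-spine-ab : ∀ d q → lexLt (spine d) (a ∷ b ∷ q) ≡ true
lexLt-spine-ab zero          q = refl
lexLt-spine-ab (suc zero)    q = refl
lexLt-spine-ab (suc (suc d)) q = refl

spine≺spine : ∀ {d d′} o o′ → d < d′ → spineNode d o ≺ spineNode d′ o′
spine≺spine {d} {d′} _ _ p rewrite reverse-spine d | reverse-spine d′ = lexLt-spine-< p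

spine≺leaf : ∀ d o d′ → spineNode d o ≺ leafNode d′
spine≺leaf d o d′ rewrite reverse-spine d | reverse-spine-++ d′ (b ∷ a ∷ []) = lexLt-spine-ab d (spine d′)

leaf≺branch : ∀ d d′ o → leafNode d ≺ branchNode d′ o
leaf≺branch d d′ o rewrite reverse-spine-++ d (b ∷ a ∷ []) | reverse-spine-++ d′ (b ∷ []) = refl

leaf⊀leaf : ∀ {d d′} → d′ ≤ d → leafNode d ⊀ leafNode d′
leaf⊀leaf {d} {d′} p rewrite reverse-spine-++ d (b ∷ a ∷ []) | reverse-spine-++ d′ (b ∷ a ∷ []) =
  lexLt-spine-≥ p

branch⊀leaf : ∀ d o d′ → branchNode d o ⊀ leafNode d′
branch⊀leaf d o d′ rewrite reverse-spine-++ d (b ∷ []) | reverse-spine-++ d′ (b ∷ a ∷ []) = refl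

branch⊀branch : ∀ {d d′} o o′ → d′ ≤ d → branchNode d o ⊀ branchNode d′ o′
branch⊀branch {d} {d′} _ _ p rewrite reverse-spine-++ d (b ∷ []) | reverse-spine-++ d′ (b ∷ []) =
  lexLt-spine-≥ p

insert-≺ : ∀ {e x xs} → e ≺ x → insert e (x ∷ xs) ≡ e ∷ x ∷ xs
insert-≺ e≺x rewrite e≺x = refl

insert-++ : ∀ {e ys} zs → All (e ⊀_) ys → insert e (ys ++ zs) ≡ ys ++ insert e zs
insert-++ zs []                         = refl
insert-++ zs (_∷_ {x = y} e⊀y e⊀ys) rewrite e⊀y = cong (y ∷_) (insert-++ zs e⊀ys)

insert-∷ʳ : ∀ {e ys} → All (e ⊀_) ys → insert e ys ≡ ys ∷ʳ e
insert-∷ʳ {e} {ys} e⊀ys = trans (cong (insert e) (sym (++-identityʳ ys))) (insert-++ [] e⊀ys)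

double-mono-< : ∀ {i u} → i < u → double i < double u
double-mono-< {zero}  (s≤s _) = s≤s z≤n
double-mono-< {suc i} (s≤s p) = s≤s (s≤s (double-mono-< p))

leaves : ℕ → List Entry
leaves = applyUpTo (leafNode ∘ double)

branchPair : ℕ → List Entry
branchPair i = branchNode (double i) onlyA ∷ branchNode (suc (double i)) [] ∷ []

branches : ℕ → List Entry
branches u = concat (applyUpTo branchPair u)

-- the off-spine nodes of the first u rungs, sorted
offSpine : ℕ → List Entry
offSpine u = leaves u ++ branches u

branches-suc : ∀ u → branches u ∷ʳ branchNode (double u) onlyA ∷ʳ branchNode (suc (double u)) []
                     ≡ branches (suc u)
branches-suc u = begin
  concat B ∷ʳ _ ∷ʳ _                      ≡⟨ ++-assoc (concat B) _ _ ⟩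
  concat B ++ branchPair u                ≡⟨ cong (concat B ++_) (sym (++-identityʳ (branchPair u))) ⟩
  concat B ++ concat (branchPair u ∷ [])  ≡⟨ concat-++ B (branchPair u ∷ []) ⟩
  concat (B ∷ʳ branchPair u)              ≡⟨ cong concat (applyUpTo-∷ʳ branchPair u) ⟩
  branches (suc u)                        ∎
  where
  open ≡-Reasoning
  B = applyUpTo branchPair u

leaf⊀leaves : ∀ u → All (leafNode (double u) ⊀_) (leaves u)
leaf⊀leaves u = applyUpTo⁺₁ (leafNode ∘ double) u (λ i<u → leaf⊀leaf (<⇒≤ (double-mono-< i<u)))

branch⊀leaves : ∀ d o u → All (branchNode d o ⊀_) (leaves u)
branch⊀leaves d o u = applyUpTo⁺₂ (leafNode ∘ double) u (λ i → branch⊀leaf d o (double i))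

branch⊀branches : ∀ {d} o u → double u ≤ d → All (branchNode d o ⊀_) (branches u)
branch⊀branches o u 2u≤d = concat⁺ (applyUpTo⁺₁ branchPair u (λ i<u →
  let 2i+1≤d = ≤-trans (double-mono-< i<u) 2u≤d in
  branch⊀branch o onlyA (≤-trans (n≤1+n _) 2i+1≤d) ∷ branch⊀branch o [] 2i+1≤d ∷ []))

leaf-before-branches : ∀ d u → insert (leafNode d) (branches u) ≡ leafNode d ∷ branches u
leaf-before-branches d zero    = refl
leaf-before-branches d (suc u) = insert-≺ (leaf≺branch d 0 onlyA)

insert-rungTail : ∀ u → foldr insert (offSpine u) (rungTail u) ≡ offSpine (suc u)
insert-rungTail u = begin
  insert β₁ (insert β₀ (insert ℓ₀ (L ++ B)))
    ≡⟨ cong (insert β₁ ∘ insert β₀) (insert-++ B (leaf⊀leaves u)) ⟩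
  insert β₁ (insert β₀ (L ++ insert ℓ₀ B))
    ≡⟨ cong (λ z → insert β₁ (insert β₀ (L ++ z))) (leaf-before-branches d u) ⟩
  insert β₁ (insert β₀ (L ++ ℓ₀ ∷ B))
    ≡⟨ cong (insert β₁ ∘ insert β₀) (trans (sym (∷ʳ-++ L ℓ₀ B)) (cong (_++ B) (applyUpTo-∷ʳ (leafNode ∘ double) u))) ⟩
  insert β₁ (insert β₀ (L′ ++ B))
    ≡⟨ cong (insert β₁) (insert-++ B (branch⊀leaves d onlyA (suc u))) ⟩
  insert β₁ (L′ ++ insert β₀ B)
    ≡⟨ insert-++ (insert β₀ B) (branch⊀leaves (suc d) [] (suc u)) ⟩
  L′ ++ insert β₁ (insert β₀ B)
    ≡⟨ cong (λ z → L′ ++ insert β₁ z) (insert-∷ʳ (branch⊀branches onlyA u ≤-refl)) ⟩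
  L′ ++ insert β₁ (B ∷ʳ β₀)
    ≡⟨ cong (L′ ++_) (insert-∷ʳ (++⁺ (branch⊀branches [] u (n≤1+n d)) (branch⊀branch [] onlyA (n≤1+n d) ∷ []))) ⟩
  L′ ++ (B ∷ʳ β₀ ∷ʳ β₁)
    ≡⟨ cong (L′ ++_) (branches-suc u) ⟩
  offSpine (suc u) ∎
  where
  open ≡-Reasoning
  d = double u
  L = leaves u
  L′ = leaves (suc u)
  B = branches u
  ℓ₀ = leafNode d
  β₀ = branchNode d onlyA
  β₁ = branchNode (suc d) []

spineFrom : ℕ → ℕ → List Entry
spineFrom d zero    = spineNode d onlyB ∷ []
spineFrom d (suc k) = spineNode d both ∷ spineFrom (suc d) k

-- the tails of the deeper rungs are inserted first, each ending up behind the previous ones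
isort-preorderFrom : ∀ t u → foldr insert (offSpine u) (preorderFrom u t)
                             ≡ spineFrom (double u) (suc (double t)) ++ offSpine (suc t + u)
isort-preorderFrom zero u rewrite insert-rungTail u =
  trans (cong (insert σ₀) (insert-≺ (spine≺leaf (suc d) onlyB 0)))
        (insert-≺ (spine≺spine {d} both onlyB ≤-refl))
  where
  d = double u
  σ₀ = spineNode d both
isort-preorderFrom (suc t) u = begin
  insert σ₀ (insert σ₁ (foldr insert (offSpine u) (preorderFrom (suc u) t ++ rungTail u)))
    ≡⟨ cong (insert σ₀ ∘ insert σ₁) (foldr-++ insert (offSpine u) (preorderFrom (suc u) t) (rungTail u)) ⟩
  insert σ₀ (insert σ₁ (foldr insert (foldr insert (offSpine u) (rungTail u)) (preorderFrom (suc u) t)))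
    ≡⟨ cong (λ z → insert σ₀ (insert σ₁ (foldr insert z (preorderFrom (suc u) t)))) (insert-rungTail u) ⟩
  insert σ₀ (insert σ₁ (foldr insert (offSpine (suc u)) (preorderFrom (suc u) t)))
    ≡⟨ cong (insert σ₀ ∘ insert σ₁) (isort-preorderFrom t (suc u)) ⟩
  insert σ₀ (insert σ₁ (S ++ offSpine (suc t + suc u)))
    ≡⟨ cong (insert σ₀) (insert-≺ (spine≺spine {suc d} both both ≤-refl)) ⟩
  insert σ₀ (σ₁ ∷ S ++ offSpine (suc t + suc u))
    ≡⟨ insert-≺ (spine≺spine {d} both both ≤-refl) ⟩
  σ₀ ∷ σ₁ ∷ S ++ offSpine (suc t + suc u)
    ≡⟨ cong (λ z → σ₀ ∷ σ₁ ∷ S ++ offSpine z) (+-suc (suc t) u) ⟩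
  σ₀ ∷ σ₁ ∷ S ++ offSpine (suc (suc t) + u) ∎
  where
  open ≡-Reasoning
  d = double u
  σ₀ = spineNode d both
  σ₁ = spineNode (suc d) both
  S = spineFrom (double (suc u)) (suc (double t))

isort-ladder : ∀ m → isort (entries (ladder m)) ≡ spineFrom 0 (suc (double m)) ++ offSpine (suc m)
isort-ladder m = begin
  isort (entries (ladder m))
    ≡⟨ cong isort (trans (sym (map-id (entries (ladder m)))) (entries-ladder m 0)) ⟩
  foldr insert (offSpine 0) (preorderFrom 0 m)
    ≡⟨ isort-preorderFrom m 0 ⟩
  spineFrom 0 (suc (double m)) ++ offSpine (suc m + 0)
    ≡⟨ cong (λ z → spineFrom 0 (suc (double m)) ++ offSpine z) (+-identityʳ (suc m)) ⟩
  spineFrom 0 (suc (double m)) ++ offSpine (suc m) ∎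
  where open ≡-Reasoning

applyUpTo-const : ∀ {A : Set} (x : A) n → applyUpTo (λ _ → x) n ≡ replicate n x
applyUpTo-const x zero    = refl
applyUpTo-const x (suc n) = cong (x ∷_) (applyUpTo-const x n)

outs-spineFrom : ∀ d k es → map proj₂ (spineFrom d k ++ es) ≡ replicate k both ++ onlyB ∷ map proj₂ es
outs-spineFrom d zero    es = refl
outs-spineFrom d (suc k) es = cong (both ∷_) (outs-spineFrom (suc d) k es)

outs-leaves : ∀ k → map proj₂ (leaves k) ≡ replicate k []
outs-leaves k = trans (map-applyUpTo (leafNode ∘ double) proj₂ k) (applyUpTo-const [] k)

outs-branches : ∀ k → map proj₂ (branches k) ≡ concat (replicate k (onlyA ∷ [] ∷ []))
outs-branches k = begin
  map proj₂ (concat (applyUpTo branchPair k))        ≡⟨ sym (concat-map (applyUpTo branchPair k)) ⟩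
  concat (map (map proj₂) (applyUpTo branchPair k))  ≡⟨ cong concat (map-applyUpTo branchPair (map proj₂) k) ⟩
  concat (applyUpTo (λ _ → onlyA ∷ [] ∷ []) k)       ≡⟨ cong concat (applyUpTo-const (onlyA ∷ [] ∷ []) k) ⟩
  concat (replicate k (onlyA ∷ [] ∷ []))             ∎
  where open ≡-Reasoning

sortedOuts-ladder : ∀ m → sortedOuts (ladder m) ≡
  both ∷ replicate (double m) both ++ onlyB ∷ [] ∷ replicate m [] ++ concat (replicate (suc m) (onlyA ∷ [] ∷ []))
sortedOuts-ladder m = begin
  map proj₂ (isort (entries (ladder m)))
    ≡⟨ cong (map proj₂) (isort-ladder m) ⟩
  map proj₂ (spineFrom 0 (suc (double m)) ++ leaves (suc m) ++ branches (suc m))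
    ≡⟨ outs-spineFrom 0 (suc (double m)) (leaves (suc m) ++ branches (suc m)) ⟩
  both ∷ replicate (double m) both ++ onlyB ∷ map proj₂ (leaves (suc m) ++ branches (suc m))
    ≡⟨ cong (λ z → both ∷ replicate (double m) both ++ onlyB ∷ z)
            (trans (map-++ proj₂ (leaves (suc m)) (branches (suc m)))
                   (cong₂ _++_ (outs-leaves (suc m)) (outs-branches (suc m)))) ⟩
  both ∷ replicate (double m) both ++ onlyB ∷ [] ∷ replicate m [] ++ concat (replicate (suc m) (onlyA ∷ [] ∷ [])) ∎
  where open ≡-Reasoning

breaks-ladder : ∀ c m → breaks c (sortedOuts (ladder m))
                        ≡ b2n (memb c both ∧ not (memb c onlyB)) + (b2n (memb c onlyB) + suc m * b2n (memb c onlyA))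
breaks-ladder c m = begin
  breaks c (sortedOuts (ladder m))
    ≡⟨ cong (breaks c) (sortedOuts-ladder m) ⟩
  breaks c (both ∷ replicate (double m) both ++ onlyB ∷ [] ∷ R)
    ≡⟨ breaks-replicate c both (double m) (onlyB ∷ [] ∷ R) ⟩
  x + breaks c (onlyB ∷ [] ∷ R)
    ≡⟨ cong (x +_) (breaks-∷[]∷ c onlyB R) ⟩
  x + (b2n (memb c onlyB) + breaks c R)
    ≡⟨ cong (λ z → x + (b2n (memb c onlyB) + z))
            (trans (breaks-replicate-[] c m A) (breaks-alternating c onlyA (suc m))) ⟩
  x + (b2n (memb c onlyB) + suc m * b2n (memb c onlyA)) ∎
  where
  open ≡-Reasoning
  A = concat (replicate (suc m) (onlyA ∷ [] ∷ []))
  R = replicate m [] ++ A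
  x = b2n (memb c both ∧ not (memb c onlyB))

runs-ladder : ∀ m → runs (ladder m) ≡ 3 + m
runs-ladder m = trans (cong₂ (λ x y → x + (y + 0)) (breaks-ladder a m) (breaks-ladder b m)) (evaluate m)
  where
  evaluate : ∀ m → 1 + (0 + suc m * 1) + ((0 + (1 + suc m * 0)) + 0) ≡ 3 + m
  evaluate = solve-∀

length-preorderFrom : ∀ u t → length (preorderFrom u t) ≡ suc t * 5
length-preorderFrom u zero    = refl
length-preorderFrom u (suc t) = cong (suc ∘ suc) (begin
  length (preorderFrom (suc u) t ++ rungTail u)  ≡⟨ length-++ (preorderFrom (suc u) t) ⟩
  length (preorderFrom (suc u) t) + 3            ≡⟨ cong (_+ 3) (length-preorderFrom (suc u) t) ⟩
  suc t * 5 + 3                                  ≡⟨ +-comm (suc t * 5) 3 ⟩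
  3 + suc t * 5                                  ∎)
  where open ≡-Reasoning

size-ladder : ∀ m → size (ladder m) ≡ suc m * 5
size-ladder m = begin
  length (entries (ladder m))                       ≡⟨ sym (length-map (under []) (entries (ladder m))) ⟩
  length (map (under []) (entries (ladder m)))      ≡⟨ cong length (entries-ladder m 0) ⟩
  length (preorderFrom 0 m)                         ≡⟨ length-preorderFrom 0 m ⟩
  suc m * 5                                         ∎
  where open ≡-Reasoning

count : ∀ {σ} → Fin σ → List (Fin σ) → ℕ
count c xs = length (filter (c ≟_) xs)

count-++ : ∀ {σ} (c : Fin σ) xs ys → count c (xs ++ ys) ≡ count c xs + count c ys
count-++ c xs ys = trans (cong length (filter-++ (c ≟_) xs ys)) (length-++ (filter (c ≟_) xs))

count-ladder-suc : ∀ c t → edgeCount (ladder (suc t)) c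
                           ≡ count c (a ∷ a ∷ []) + (edgeCount (ladder t) c + count c onlyB + count c (b ∷ a ∷ []))
count-ladder-suc c t =
  trans (count-++ c (a ∷ a ∷ []) ((E ++ onlyB) ++ b ∷ a ∷ []))
        (cong (count c (a ∷ a ∷ []) +_)
              (trans (count-++ c (E ++ onlyB) (b ∷ a ∷ [])) (cong (_+ count c (b ∷ a ∷ [])) (count-++ c E onlyB))))
  where E = edgeLabels (ladder t)

edgeCount-ladder-a : ∀ t → edgeCount (ladder t) a ≡ 2 + t * 3
edgeCount-ladder-a zero    = refl
edgeCount-ladder-a (suc t) =
  trans (count-ladder-suc a t) (trans (cong (λ z → 2 + (z + 0 + 1)) (edgeCount-ladder-a t)) (recurrence t))
  where
  recurrence : ∀ t → 2 + ((2 + t * 3) + 0 + 1) ≡ 2 + suc t * 3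
  recurrence = solve-∀

edgeCount-ladder-b : ∀ t → edgeCount (ladder t) b ≡ 2 + t * 2
edgeCount-ladder-b zero    = refl
edgeCount-ladder-b (suc t) =
  trans (count-ladder-suc b t) (trans (cong (λ z → 0 + (z + 1 + 1)) (edgeCount-ladder-b t)) (recurrence t))
  where
  recurrence : ∀ t → 0 + ((2 + t * 2) + 1 + 1) ≡ 2 + suc t * 2
  recurrence = solve-∀

^-distribʳ-* : ∀ m n o → (m * n) ^ o ≡ m ^ o * n ^ o
^-distribʳ-* m n zero    = refl
^-distribʳ-* m n (suc o) = trans (cong (m * n *_) (^-distribʳ-* m n o)) (interchange m n (m ^ o) (n ^ o))
  where
  interchange : ∀ w x y z → w * x * (y * z) ≡ w * y * (x * z)
  interchange = solve-∀

m^m*n^n≤[m+n]^[m+n] : ∀ m n → m ^ m * n ^ n ≤ (m + n) ^ (m + n)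
m^m*n^n≤[m+n]^[m+n] m n = begin
  m ^ m * n ^ n              ≤⟨ *-mono-≤ (^-monoˡ-≤ m (m≤m+n m n)) (^-monoˡ-≤ n (m≤n+m n m)) ⟩
  (m + n) ^ m * (m + n) ^ n  ≡⟨ ^-distribˡ-+-* (m + n) m n ⟨
  (m + n) ^ (m + n)          ∎
  where open ≤-Reasoning

[m+n]^[m+n]≤c^[m+n]*m^m*n^n : ∀ c m n → m + n ≤ c * m → m + n ≤ c * n →
                              (m + n) ^ (m + n) ≤ c ^ (m + n) * (m ^ m * n ^ n)
[m+n]^[m+n]≤c^[m+n]*m^m*n^n c m n p q = begin
  (m + n) ^ (m + n)                  ≡⟨ ^-distribˡ-+-* (m + n) m n ⟩
  (m + n) ^ m * (m + n) ^ n          ≤⟨ *-mono-≤ (^-monoˡ-≤ m p) (^-monoˡ-≤ n q) ⟩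
  (c * m) ^ m * (c * n) ^ n          ≡⟨ cong₂ _*_ (^-distribʳ-* c m m) (^-distribʳ-* c n n) ⟩
  (c ^ m * m ^ m) * (c ^ n * n ^ n)  ≡⟨ interchange (c ^ m) (m ^ m) (c ^ n) (n ^ n) ⟩
  (c ^ m * c ^ n) * (m ^ m * n ^ n)  ≡⟨ cong (_* (m ^ m * n ^ n)) (^-distribˡ-+-* c m n) ⟨
  c ^ (m + n) * (m ^ m * n ^ n)      ∎
  where
  open ≤-Reasoning
  interchange : ∀ w x y z → (w * x) * (y * z) ≡ (w * y) * (x * z)
  interchange = solve-∀

2^m*m^m*n^n≤[m+n]^[m+n] : ∀ m n → m ≤ n → 2 ^ m * (m ^ m * n ^ n) ≤ (m + n) ^ (m + n)
2^m*m^m*n^n≤[m+n]^[m+n] m n m≤n = begin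
  2 ^ m * (m ^ m * n ^ n)    ≡⟨ *-assoc (2 ^ m) (m ^ m) (n ^ n) ⟨
  (2 ^ m * m ^ m) * n ^ n    ≡⟨ cong (_* n ^ n) (^-distribʳ-* 2 m m) ⟨
  (2 * m) ^ m * n ^ n        ≤⟨ *-mono-≤ (^-monoˡ-≤ m 2m≤m+n) (^-monoˡ-≤ n (m≤n+m n m)) ⟩
  (m + n) ^ m * (m + n) ^ n  ≡⟨ ^-distribˡ-+-* (m + n) m n ⟨
  (m + n) ^ (m + n)          ∎
  where
  open ≤-Reasoning
  2m≤m+n : 2 * m ≤ m + n
  2m≤m+n = subst (_≤ m + n) (cong (m +_) (sym (+-identityʳ m))) (+-monoʳ-≤ m m≤n)

m+o≡n⇒m≤n : ∀ {m o n} → m + o ≡ n → m ≤ n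
m+o≡n⇒m≤n eq = m+n≤o⇒m≤o _ (≤-reflexive eq)

term-∸ : ∀ {n c} k l → n ≡ k + l → c ≡ k → c ^ c * (n ∸ c) ^ (n ∸ c) ≡ k ^ k * l ^ l
term-∸ k l refl refl rewrite m+n∸m≡n k l = refl

-- each of the two letters contributes at most 2n to n·H₀, so n·H₀ ≤ 4n ≤ q·r
scaledLogLe-two : ∀ q n D₁ D₂ r → n ^ n ≤ 4 ^ n * D₁ → n ^ n ≤ 4 ^ n * D₂ → 4 * n ≤ q * r →
                  ScaledLogLe 1 q (n ^ n * (n ^ n * 1)) (D₁ * (D₂ * 1)) r
scaledLogLe-two q n D₁ D₂ r p₁ p₂ 4n≤qr = begin
  (n ^ n * (n ^ n * 1)) ^ 1            ≡⟨ *-identityʳ _ ⟩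
  n ^ n * (n ^ n * 1)                  ≤⟨ *-mono-≤ p₁ (*-monoˡ-≤ 1 p₂) ⟩
  (4 ^ n * D₁) * ((4 ^ n * D₂) * 1)    ≡⟨ interchange (4 ^ n) D₁ D₂ ⟩
  (4 ^ n * 4 ^ n) * (D₁ * (D₂ * 1))    ≡⟨ cong (_* (D₁ * (D₂ * 1))) 4^n*4^n≡2^[4n] ⟩
  2 ^ (4 * n) * (D₁ * (D₂ * 1))        ≤⟨ *-monoˡ-≤ (D₁ * (D₂ * 1)) (^-monoʳ-≤ 2 4n≤qr) ⟩
  2 ^ (q * r) * (D₁ * (D₂ * 1))        ≡⟨ cong (2 ^ (q * r) *_) (*-identityʳ _) ⟨
  2 ^ (q * r) * (D₁ * (D₂ * 1)) ^ 1    ∎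
  where
  open ≤-Reasoning
  interchange : ∀ f x y → (f * x) * ((f * y) * 1) ≡ (f * f) * (x * (y * 1))
  interchange = solve-∀
  4^n*4^n≡2^[4n] : 4 ^ n * 4 ^ n ≡ 2 ^ (4 * n)
  4^n*4^n≡2^[4n] = begin-equality
    4 ^ n * 4 ^ n    ≡⟨ ^-distribˡ-+-* 4 n n ⟨
    4 ^ (n + n)      ≡⟨ ^-*-assoc 2 2 (n + n) ⟩
    2 ^ (2 * (n + n)) ≡⟨ cong (2 ^_) (double≡ n) ⟩
    2 ^ (4 * n)      ∎
    where
    double≡ : ∀ n → 2 * (n + n) ≡ 4 * n
    double≡ = solve-∀

-- the second letter alone contributes at least k to n·H₀
leScaledLog-two : ∀ N D₁ D₂ k r → D₁ ≤ N → 2 ^ k * D₂ ≤ N → r ≤ k →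
                  LeScaledLog 1 1 (N * (N * 1)) (D₁ * (D₂ * 1)) r
leScaledLog-two N D₁ D₂ k r p₁ p₂ r≤k = begin
  2 ^ (1 * r) * (D₁ * (D₂ * 1)) ^ 1  ≡⟨ cong₂ (λ x y → 2 ^ x * y) (+-identityʳ r) (*-identityʳ _) ⟩
  2 ^ r * (D₁ * (D₂ * 1))            ≤⟨ *-monoˡ-≤ (D₁ * (D₂ * 1)) (^-monoʳ-≤ 2 r≤k) ⟩
  2 ^ k * (D₁ * (D₂ * 1))            ≡⟨ rearrange (2 ^ k) D₁ D₂ ⟩
  D₁ * ((2 ^ k * D₂) * 1)            ≤⟨ *-mono-≤ p₁ (*-monoˡ-≤ 1 p₂) ⟩
  N * (N * 1)                        ≡⟨ *-identityʳ _ ⟨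
  (N * (N * 1)) ^ 1                  ∎
  where
  open ≤-Reasoning
  rearrange : ∀ f x y → f * (x * (y * 1)) ≡ x * ((f * y) * 1)
  rearrange = solve-∀

module _ (m : ℕ) where
  private
    n ka la kb lb Da Db : ℕ
    n  = suc m * 5
    ka = 2 + m * 3
    la = 3 + m * 2
    kb = 2 + m * 2
    lb = 3 + m * 3
    Da = ka ^ ka * la ^ la
    Db = kb ^ kb * lb ^ lb

    n≡ka+la : n ≡ ka + la
    n≡ka+la = e m where
      e : ∀ m → suc m * 5 ≡ (2 + m * 3) + (3 + m * 2)
      e = solve-∀

    n≡kb+lb : n ≡ kb + lb
    n≡kb+lb = e m where
      e : ∀ m → suc m * 5 ≡ (2 + m * 2) + (3 + m * 3)
      e = solve-∀

    nH0num-ladder : nH0num (ladder m) ≡ n ^ n * (n ^ n * 1)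
    nH0num-ladder = cong (λ s → s ^ s * (s ^ s * 1)) (size-ladder m)

    nH0den-ladder : nH0den (ladder m) ≡ Da * (Db * 1)
    nH0den-ladder = cong₂ (λ x y → x * (y * 1))
      (term-∸ ka la (trans (size-ladder m) n≡ka+la) (edgeCount-ladder-a m))
      (term-∸ kb lb (trans (size-ladder m) n≡kb+lb) (edgeCount-ladder-b m))

    n^n≤4^n*Da : n ^ n ≤ 4 ^ n * Da
    n^n≤4^n*Da = subst (λ z → z ^ z ≤ 4 ^ z * Da) (sym n≡ka+la)
      ([m+n]^[m+n]≤c^[m+n]*m^m*n^n 4 ka la (m+o≡n⇒m≤n (e₁ m)) (m+o≡n⇒m≤n (e₂ m)))
      where
      e₁ : ∀ m → (2 + m * 3) + (3 + m * 2) + (3 + m * 7) ≡ 4 * (2 + m * 3)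
      e₁ = solve-∀
      e₂ : ∀ m → (2 + m * 3) + (3 + m * 2) + (7 + m * 3) ≡ 4 * (3 + m * 2)
      e₂ = solve-∀

    n^n≤4^n*Db : n ^ n ≤ 4 ^ n * Db
    n^n≤4^n*Db = subst (λ z → z ^ z ≤ 4 ^ z * Db) (sym n≡kb+lb)
      ([m+n]^[m+n]≤c^[m+n]*m^m*n^n 4 kb lb (m+o≡n⇒m≤n (e₁ m)) (m+o≡n⇒m≤n (e₂ m)))
      where
      e₁ : ∀ m → (2 + m * 2) + (3 + m * 3) + (3 + m * 3) ≡ 4 * (2 + m * 2)
      e₁ = solve-∀
      e₂ : ∀ m → (2 + m * 2) + (3 + m * 3) + (7 + m * 7) ≡ 4 * (3 + m * 3)
      e₂ = solve-∀

  ladder-runs-upper : ScaledLogLe 1 20 (nH0num (ladder m)) (nH0den (ladder m)) (runs (ladder m))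
  ladder-runs-upper rewrite nH0num-ladder | nH0den-ladder | runs-ladder m =
    scaledLogLe-two 20 n Da Db (3 + m) n^n≤4^n*Da n^n≤4^n*Db (m+o≡n⇒m≤n (e m))
    where
    e : ∀ m → 4 * (suc m * 5) + 40 ≡ 20 * (3 + m)
    e = solve-∀

  ladder-runs-lower : 1 ≤ m → LeScaledLog 1 1 (nH0num (ladder m)) (nH0den (ladder m)) (runs (ladder m))
  ladder-runs-lower 1≤m rewrite nH0num-ladder | nH0den-ladder | runs-ladder m =
    leScaledLog-two (n ^ n) Da Db kb (3 + m)
      (subst (λ z → Da ≤ z ^ z) (sym n≡ka+la) (m^m*n^n≤[m+n]^[m+n] ka la))
      (subst (λ z → 2 ^ kb * Db ≤ z ^ z) (sym n≡kb+lb)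
             (2^m*m^m*n^n≤[m+n]^[m+n] kb lb (m+o≡n⇒m≤n (e m))))
      (subst (3 + m ≤_) (e′ m) (+-monoˡ-≤ (2 + m) 1≤m))
    where
    e : ∀ m → (2 + m * 2) + (1 + m) ≡ 3 + m * 3
    e = solve-∀
    e′ : ∀ m → m + (2 + m) ≡ 2 + m * 2
    e′ = solve-∀

proposition19 : ∃ λ (a₁ : ℕ) → ∃ λ (a₂ : ℕ) → ∃ λ (b₁ : ℕ) → ∃ λ (b₂ : ℕ) →
    a₁ > 0 × a₂ > 0 × b₁ > 0 × b₂ > 0 ×
    ((N : ℕ) → ∃ λ (σ : ℕ) → ∃ λ (T : Trie σ) →
      WF T × N ≤ size T ×
      ScaledLogLe a₁ a₂ (nH0num T) (nH0den T) (runs T) ×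
      LeScaledLog b₁ b₂ (nH0num T) (nH0den T) (runs T))
proposition19 = 1 , 20 , 1 , 1 , s≤s z≤n , s≤s z≤n , s≤s z≤n , s≤s z≤n , λ N →
  2 , ladder (suc N) , wf-ladder (suc N) ,
  subst (N ≤_) (sym (size-ladder (suc N))) (m+o≡n⇒m≤n (e N)) ,
  ladder-runs-upper (suc N) , ladder-runs-lower (suc N) (s≤s z≤n)
  where
  e : ∀ N → N + (10 + N * 4) ≡ suc (suc N) * 5
  e = solve-∀
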